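{- Let $G$ be an $n$-vertex graph with minimum degree $\delta:=\delta(G)$, and let $P$ be a path in $G$ with endpoints $x,y$ such that $|P|>20n/\delta$. Then there is an $xy$-path $P'$ in $G$ such that $|P|-20n/\delta\le |P'|<|P|$.
   Context: All graphs are finite and simple. For a path $P$, $|P|$ denotes the number of vertices of $P$. An $xy$-path is a path with endpoints $x$ and $y$. -}

module Defs where

open import Data.Nat using (ℕ; zero; suc; _+_; _≤_)
open import Data.Bool using (Bool; true; false; if_then_else_)
open import Data.Fin using (Fin)
open import Data.List using (List; []; _∷_; length; map; allFin)
open import Data.Nat.ListAction using (sum)
open import Data.List.Relation.Unary.Unique.Propositional using (Unique)
open import Data.Product using (Σ; _×_)
open import Relation.Binary.PropositionalEquality using (_≡_)

record Graph (n : ℕ) : Set where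
  field
    adj    : Fin n → Fin n → Bool
    sym    : ∀ u v → adj u v ≡ adj v u
    irrefl : ∀ v → adj v v ≡ false
open Graph public

degree : ∀ {n} → Graph n → Fin n → ℕ
degree {n} G v = sum (map (λ w → if adj G v w then 1 else 0) (allFin n))

IsMinDegree : ∀ {n} → Graph n → ℕ → Set
IsMinDegree G δ = (∀ v → δ ≤ degree G v) × Σ _ (λ v → degree G v ≡ δ)

data Walk {n : ℕ} (G : Graph n) : Fin n → Fin n → List (Fin n) → Set where
  single : ∀ {x} → Walk G x x (x ∷ [])
  step   : ∀ {x y z vs} → adj G x y ≡ true → Walk G y z vs → Walk G x z (x ∷ vs)

-- An xy-path: a walk from x to y with pairwise distinct vertices.
-- Its number of vertices |P| is  length vs.
IsPath : ∀ {n} → Graph n → Fin n → Fin n → List (Fin n) → Set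
IsPath G x y vs = Walk G x y vs × Unique vs

{-# OPTIONS --safe #-}

-- Write P = v₀ … v_{m-1} and L = ⌊10n/δ⌋, so that 2Lδ ≤ 20n; it suffices to find an xy-path that is
-- shorter than P by at least 1 and at most 2L vertices. Suppose there is none, and count the
-- neighbours of v₀, …, v_{L-1}. An off-path vertex w is adjacent to at most three of them (otherwise
-- v_i w v_j with j ≥ i + 3 is a shortcut); v_i has no neighbour v_j with j < i - 1 (the chord v_j v_i
-- would be a shortcut); and for each t at most two of them have the forward chord v_i v_{i+2+t}, since
-- two such chords at a and c ≥ a + 2 either cross, and v₀ … v_a v_{a+2+t} … v_c v_{c+2+t} … is a
-- shortcut, or the first one ends before c and is itself a shortcut. Hence Lδ ≤ 3n + 2L + 2m ≤ 6n
-- (m ≤ n, and 2L ≤ n because δ > 20), contradicting 10n < δ + Lδ.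
module Submission where

open import Defs hiding (sym)
open import Algebra.Properties.CommutativeSemigroup using (interchange)
open import Data.Bool using (Bool; true; false; if_then_else_; _∧_; not)
import Data.Bool as Bool
open import Data.Bool.Properties using (¬-not; T-≡)
open import Data.Empty using (⊥; ⊥-elim)
open import Data.Fin using (Fin; zero; suc)
open import Data.Fin.Properties using (_≟_; injective⇒≤)
open import Data.List using (List; []; _∷_; length; map; allFin; downFrom; lookup; take; drop; reverse; _++_)
import Data.List.Membership.DecPropositional as DecPropositional
open import Data.List.Membership.Propositional using (_∈_; _∉_)
open import Data.List.Membership.Propositional.Properties using (∈-downFrom⁺; ∈-downFrom⁻; ∈-lookup; ∈-++⁻)
open import Data.List.Properties using (map-tabulate; length-downFrom; length-tabulate; unfold-reverse; length-take; length-drop; length-++; length-reverse)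
open import Data.List.Relation.Binary.Permutation.Propositional using (↭⇒↭ₛ; ↭-sym)
open import Data.List.Relation.Binary.Permutation.Propositional.Properties using (↭-reverse)
open import Data.List.Relation.Binary.Permutation.Setoid.Properties using (Unique-resp-↭)
import Data.List.Relation.Binary.Sublist.Propositional as Sublist
open import Data.List.Relation.Binary.Sublist.Propositional.Properties using (take-⊆; drop-⊆)
open import Data.List.Relation.Unary.All.Properties using (All¬⇒¬Any; ¬Any⇒All¬)
open import Data.List.Relation.Unary.AllPairs using (_∷_)
open import Data.List.Relation.Unary.Any using (here; there)
open import Data.List.Relation.Unary.Any.Properties using (reverse⁻)
open import Data.List.Relation.Unary.Unique.Propositional using (Unique)
open import Data.List.Relation.Unary.Unique.Propositional.Properties using (++⁺; take⁺; drop⁺)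
open import Data.Nat using (ℕ; zero; suc; _+_; _*_; _∸_; _≤_; _<_; z≤n; s≤s; _<?_; _<ᵇ_; NonZero)
open import Data.Nat.DivMod using (_/_; m/n*n≤m; m≡m%n+[m/n]*n; m%n<n)
open import Data.Nat.ListAction using (sum)
open import Data.Nat.Properties hiding (_≟_)
open import Data.Nat.Tactic.RingSolver using (solve-∀)
open import Data.Product using (Σ; ∃₂; _×_; _,_)
open import Data.Sum using (_⊎_; inj₁; inj₂; [_,_]; fromInj₁; map₁)
open import Function using (_∘_; Equivalence)
open import Relation.Binary.Definitions using (tri<; tri≈; tri>)
open import Relation.Binary.PropositionalEquality hiding ([_])
open import Relation.Nullary using (does; yes; no)
open import Relation.Nullary.Decidable using (_×-dec_; dec-true)

𝟙 : Bool → ℕ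
𝟙 b = if b then 1 else 0

𝟙≤1 : ∀ b → 𝟙 b ≤ 1
𝟙≤1 true  = ≤-refl
𝟙≤1 false = z≤n

∑∈ : {A : Set} → List A → (A → ℕ) → ℕ
∑∈ xs f = sum (map f xs)

syntax ∑∈ xs (λ a → e) = ∑[ a ∈ xs ] e

∑< : ℕ → (ℕ → ℕ) → ℕ
∑< k f = ∑∈ (downFrom k) f

syntax ∑< k (λ i → e) = ∑[ i < k ] e

module _ {A : Set} where

  ∑-mono⊎ : ∀ {R : Set} (xs : List A) {f g : A → ℕ} →
            (∀ {a} → a ∈ xs → f a ≤ g a ⊎ R) → ∑∈ xs f ≤ ∑∈ xs g ⊎ R
  ∑-mono⊎ []       h = inj₁ z≤n
  ∑-mono⊎ (x ∷ xs) h with h (here refl) | ∑-mono⊎ xs (h ∘ there)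
  ... | inj₂ r   | _        = inj₂ r
  ... | inj₁ _   | inj₂ r   = inj₂ r
  ... | inj₁ f≤g | inj₁ ∑f≤∑g = inj₁ (+-mono-≤ f≤g ∑f≤∑g)

  ∑-mono : (xs : List A) {f g : A → ℕ} → (∀ {a} → a ∈ xs → f a ≤ g a) → ∑∈ xs f ≤ ∑∈ xs g
  ∑-mono xs h = fromInj₁ ⊥-elim (∑-mono⊎ xs (inj₁ ∘ h))

  ∑-const : (xs : List A) (c : ℕ) → ∑[ _ ∈ xs ] c ≡ length xs * c
  ∑-const []       c = refl
  ∑-const (x ∷ xs) c = cong (c +_) (∑-const xs c)

  ∑-distrib-+ : (xs : List A) (f g : A → ℕ) → ∑[ a ∈ xs ] (f a + g a) ≡ ∑∈ xs f + ∑∈ xs g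
  ∑-distrib-+ []       f g = refl
  ∑-distrib-+ (x ∷ xs) f g = trans (cong (f x + g x +_) (∑-distrib-+ xs f g))
                                   (interchange +-commutativeSemigroup (f x) (g x) _ _)

  ∑-term : (xs : List A) (f : A → ℕ) {a : A} → a ∈ xs → f a ≤ ∑∈ xs f
  ∑-term (x ∷ xs) f (here refl) = m≤m+n (f x) _
  ∑-term (x ∷ xs) f (there a∈) = ≤-trans (∑-term xs f a∈) (m≤n+m _ (f x))

  ∑-𝟙≤length : (xs : List A) (p : A → Bool) → ∑[ a ∈ xs ] 𝟙 (p a) ≤ length xs
  ∑-𝟙≤length []       p = z≤n
  ∑-𝟙≤length (x ∷ xs) p = +-mono-≤ (𝟙≤1 (p x)) (∑-𝟙≤length xs p)

∑-comm : ∀ {A B : Set} (xs : List A) (ys : List B) (f : A → B → ℕ) →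
         ∑[ a ∈ xs ] ∑[ b ∈ ys ] f a b ≡ ∑[ b ∈ ys ] ∑[ a ∈ xs ] f a b
∑-comm []       ys f = sym (trans (∑-const ys 0) (*-zeroʳ (length ys)))
∑-comm (x ∷ xs) ys f = trans (cong (∑∈ ys (f x) +_) (∑-comm xs ys f))
                             (sym (∑-distrib-+ ys (f x) (λ b → ∑[ a ∈ xs ] f a b)))

∑<-const : ∀ k c → ∑[ _ < k ] c ≡ k * c
∑<-const k c = trans (∑-const (downFrom k) c) (cong (_* c) (length-downFrom k))

∑<-mono⊎ : ∀ {R : Set} k {f g : ℕ → ℕ} → (∀ i → i < k → f i ≤ g i ⊎ R) → ∑< k f ≤ ∑< k g ⊎ R
∑<-mono⊎ k h = ∑-mono⊎ (downFrom k) (h _ ∘ ∈-downFrom⁻)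

∑<-mono : ∀ k {f g : ℕ → ℕ} → (∀ i → i < k → f i ≤ g i) → ∑< k f ≤ ∑< k g
∑<-mono k h = ∑-mono (downFrom k) (h _ ∘ ∈-downFrom⁻)

∑<-term : ∀ k (f : ℕ → ℕ) {t} → t < k → f t ≤ ∑< k f
∑<-term k f t<k = ∑-term (downFrom k) f (∈-downFrom⁺ t<k)

length-allFin : ∀ n → length (allFin n) ≡ n
length-allFin n = length-tabulate {n = n} (λ w → w)

∑-allFin-suc : ∀ n (g : Fin (suc n) → ℕ) → ∑∈ (allFin (suc n)) g ≡ g zero + ∑[ w ∈ allFin n ] g (suc w)
∑-allFin-suc n g = cong (λ ws → g zero + sum ws) (trans (map-tabulate suc g) (sym (map-tabulate (λ w → w) (g ∘ suc))))

∑-𝟙-≟ : ∀ n (u : Fin n) c → ∑[ w ∈ allFin n ] 𝟙 (c ∧ does (w ≟ u)) ≤ 𝟙 c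
∑-𝟙-≟ n u false = ≤-reflexive (trans (∑-const (allFin n) 0) (*-zeroʳ (length (allFin n))))
∑-𝟙-≟ (suc n) zero true rewrite ∑-allFin-suc n (λ w → 𝟙 (does (w ≟ zero))) | ∑-const (allFin n) 0
  = ≤-reflexive (cong suc (*-zeroʳ (length (allFin n))))
∑-𝟙-≟ (suc n) (suc u) true rewrite ∑-allFin-suc n (λ w → 𝟙 (does (w ≟ suc u))) = ∑-𝟙-≟ n u true

FarTruePair : (ℕ → Bool) → ℕ → ℕ → Set
FarTruePair f k L = ∃₂ λ i j → i + k < j × j < L × f i ≡ true × f j ≡ true

∑-𝟙-false-below : (f : ℕ → Bool) (L k : ℕ) → (∀ i → i + k < L → f i ≡ false) → ∑[ i < L ] 𝟙 (f i) ≤ k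
∑-𝟙-false-below f zero    k       h = z≤n
∑-𝟙-false-below f (suc L) zero    h rewrite h L (s≤s (≤-reflexive (+-identityʳ L)))
  = ∑-𝟙-false-below f L zero (λ i i<L → h i (m≤n⇒m≤1+n i<L))
∑-𝟙-false-below f (suc L) (suc k) h
  = +-mono-≤ (𝟙≤1 (f L)) (∑-𝟙-false-below f L k (λ i i+k<L → h i (subst (_< suc L) (sym (+-suc i k)) (s≤s i+k<L))))

∑-𝟙≤⊎FarTruePair : (f : ℕ → Bool) (k L : ℕ) → ∑[ i < L ] 𝟙 (f i) ≤ suc k ⊎ FarTruePair f k L
∑-𝟙≤⊎FarTruePair f k zero = inj₁ z≤n
∑-𝟙≤⊎FarTruePair f k (suc L) with ∑-𝟙≤⊎FarTruePair f k L
... | inj₂ (i , j , i+k<j , j<L , fi , fj) = inj₂ (i , j , i+k<j , m≤n⇒m≤1+n j<L , fi , fj)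
... | inj₁ bound with f L in fL
...   | false = inj₁ bound
...   | true with anyUpTo? (λ i → (i + k <? L) ×-dec (f i Bool.≟ true)) L
...     | yes (i , _ , i+k<L , fi) = inj₂ (i , L , i+k<L , ≤-refl , fi , fL)
...     | no ∄ = inj₁ (s≤s (∑-𝟙-false-below f L k
                   (λ i i+k<L → ¬-not (λ fi → ∄ (i , m+n≤o⇒m≤o (suc i) i+k<L , i+k<L , fi)))))

module _ {A : Set} where

  lookupOr : A → List A → ℕ → A
  lookupOr d []       _       = d
  lookupOr d (a ∷ as) zero    = a
  lookupOr d (a ∷ as) (suc i) = lookupOr d as i

  lookupOr-drop : ∀ (d : A) c xs j → lookupOr d (drop c xs) j ≡ lookupOr d xs (c + j)
  lookupOr-drop d zero    xs       j = refl
  lookupOr-drop d (suc c) []       j = refl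
  lookupOr-drop d (suc c) (x ∷ xs) j = lookupOr-drop d c xs j

  ∈⇒lookupOr : ∀ (d : A) {w} xs → w ∈ xs → Σ ℕ λ j → j < length xs × w ≡ lookupOr d xs j
  ∈⇒lookupOr d (x ∷ xs) (here w≡x) = zero , s≤s z≤n , w≡x
  ∈⇒lookupOr d (x ∷ xs) (there w∈) with ∈⇒lookupOr d xs w∈
  ... | j , j<len , w≡ = suc j , s≤s j<len , w≡

  length-take-≤ : ∀ k (xs : List A) → k ≤ length xs → length (take k xs) ≡ k
  length-take-≤ k xs k≤ = trans (length-take k xs) (m≤n⇒m⊓n≡m k≤)

  ∈-take : ∀ {v : A} k xs → v ∈ take k xs → v ∈ xs
  ∈-take k xs = Sublist.lookup (take-⊆ k xs)

  ∈-drop : ∀ {v : A} k xs → v ∈ drop k xs → v ∈ xs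
  ∈-drop k xs = Sublist.lookup (drop-⊆ k xs)

  Unique-lookup-injective : ∀ (xs : List A) → Unique xs → ∀ {i j} → lookup xs i ≡ lookup xs j → i ≡ j
  Unique-lookup-injective (x ∷ xs) (x∉ ∷ u) {zero}  {zero}  _ = refl
  Unique-lookup-injective (x ∷ xs) (x∉ ∷ u) {zero}  {suc j} e =
    ⊥-elim (All¬⇒¬Any x∉ (subst (_∈ xs) (sym e) (∈-lookup j)))
  Unique-lookup-injective (x ∷ xs) (x∉ ∷ u) {suc i} {zero}  e =
    ⊥-elim (All¬⇒¬Any x∉ (subst (_∈ xs) e (∈-lookup i)))
  Unique-lookup-injective (x ∷ xs) (x∉ ∷ u) {suc i} {suc j} e = cong suc (Unique-lookup-injective xs u e)

  Unique-reverse : (xs : List A) → Unique xs → Unique (reverse xs)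
  Unique-reverse xs = Unique-resp-↭ (setoid A) (↭⇒↭ₛ (↭-sym (↭-reverse xs)))

  Unique-window-∉-drop : ∀ {v : A} (xs : List A) → Unique xs → ∀ c j b → c + j ≤ b →
                         v ∈ take j (drop c xs) → v ∉ drop b xs
  Unique-window-∉-drop (x ∷ xs) (x∉ ∷ u) zero (suc j) (suc b) (s≤s le) (here refl) =
    All¬⇒¬Any x∉ ∘ ∈-drop b xs
  Unique-window-∉-drop (x ∷ xs) (x∉ ∷ u) zero (suc j) (suc b) (s≤s le) (there v∈) =
    Unique-window-∉-drop xs u zero j b le v∈
  Unique-window-∉-drop (x ∷ xs) (x∉ ∷ u) (suc c) j (suc b) (s≤s le) v∈ =
    Unique-window-∉-drop xs u c j b le v∈

Unique⇒length≤ : ∀ {n} (xs : List (Fin n)) → Unique xs → length xs ≤ n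
Unique⇒length≤ xs u = injective⇒≤ (Unique-lookup-injective xs u)

module _ {n : ℕ} (G : Graph n) where

  walk-take : ∀ {x y vs} → Walk G x y vs → ∀ d k → k < length vs → Walk G x (lookupOr d vs k) (take (suc k) vs)
  walk-take single     d zero    _       = single
  walk-take single     d (suc k) (s≤s ())
  walk-take (step e w) d zero    _       = single
  walk-take (step e w) d (suc k) (s≤s k<) = step e (walk-take w d k k<)

  walk-drop : ∀ {x y vs} → Walk G x y vs → ∀ d k → k < length vs → Walk G (lookupOr d vs k) y (drop k vs)
  walk-drop single     d zero    _       = single
  walk-drop single     d (suc k) (s≤s ())
  walk-drop (step e w) d zero    _       = step e w
  walk-drop (step e w) d (suc k) (s≤s k<) = walk-drop w d k k<

  walk-++ : ∀ {a b c d xs ys} → Walk G a b xs → adj G b c ≡ true → Walk G c d ys → Walk G a d (xs ++ ys)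
  walk-++ single      e w′ = step e w′
  walk-++ (step e′ w) e w′ = step e′ (walk-++ w e w′)

  walk-reverse : ∀ {a b xs} → Walk G a b xs → Walk G b a (reverse xs)
  walk-reverse single = single
  walk-reverse (step {x} {y} {_} {vs} e w) rewrite unfold-reverse x vs =
    walk-++ (walk-reverse w) (trans (Graph.sym G y x) e) single

module Shortcuts {n : ℕ} (G : Graph n) {x y : Fin n} {P : List (Fin n)} (WP : Walk G x y P) (U : Unique P) where

  m : ℕ
  m = length P

  -- v i is junk (namely x) for i ≥ m.
  v : ℕ → Fin n
  v = lookupOr x P

  PathShorterBy : ℕ → Set
  PathShorterBy p = Σ (List (Fin n)) λ P′ → IsPath G x y P′ × length P′ + p ≡ m

  splice-length : ∀ a d mid loss → suc a + (length mid + loss) ≡ d → d ≤ m →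
                  length (take (suc a) P ++ (mid ++ drop d P)) + loss ≡ m
  splice-length a d mid loss a+mid+loss≡d d≤m = begin
    length (take (suc a) P ++ (mid ++ drop d P)) + loss
      ≡⟨ cong (_+ loss) (length-++ (take (suc a) P)) ⟩
    length (take (suc a) P) + length (mid ++ drop d P) + loss
      ≡⟨ cong₂ (λ z z′ → z + z′ + loss) (length-take-≤ (suc a) P a<m)
                                        (trans (length-++ mid) (cong (length mid +_) (length-drop d P))) ⟩
    suc a + (length mid + (m ∸ d)) + loss
      ≡⟨ lemma (suc a) (length mid) (m ∸ d) loss ⟩
    suc a + (length mid + loss) + (m ∸ d)
      ≡⟨ cong (_+ (m ∸ d)) a+mid+loss≡d ⟩
    d + (m ∸ d)
      ≡⟨ m+[n∸m]≡n d≤m ⟩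
    m ∎
    where
    open ≡-Reasoning
    a<m : suc a ≤ m
    a<m = ≤-trans (m≤m+n (suc a) _) (subst (_≤ m) (sym a+mid+loss≡d) d≤m)
    lemma : ∀ a l s loss → a + (l + s) + loss ≡ a + (l + loss) + s
    lemma = solve-∀

  chord-shortcut : ∀ a p → suc a + p < m → adj G (v a) (v (suc a + p)) ≡ true → PathShorterBy p
  chord-shortcut a p b<m e = take (suc a) P ++ drop b P ,
      (walk-++ G (walk-take G WP x a a<m) e (walk-drop G WP x b b<m) ,
       ++⁺ (take⁺ (suc a) U) (drop⁺ b U) (λ (u∈ , u∈′) → Unique-window-∉-drop P U zero (suc a) b (m≤m+n (suc a) p) u∈ u∈′)) ,
      splice-length a b [] p refl (<⇒≤ b<m)
    where
    b = suc a + p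
    a<m : a < m
    a<m = ≤-<-trans (m≤m+n a p) (<-trans (n<1+n (a + p)) b<m)

  detour-shortcut : ∀ a p w → suc (suc a) + p < m → w ∉ P →
                    adj G (v a) w ≡ true → adj G w (v (suc (suc a) + p)) ≡ true → PathShorterBy p
  detour-shortcut a p w b<m w∉ e e′ = take (suc a) P ++ (w ∷ drop b P) ,
      (walk-++ G (walk-take G WP x a a<m) e (step e′ (walk-drop G WP x b b<m)) ,
       ++⁺ (take⁺ (suc a) U) (¬Any⇒All¬ _ (w∉ ∘ ∈-drop b P) ∷ drop⁺ b U) disjoint) ,
      splice-length a b (w ∷ []) p (+-suc (suc a) p) (<⇒≤ b<m)
    where
    b = suc (suc a) + p
    a<b : suc a ≤ b
    a<b = ≤-trans (n≤1+n (suc a)) (m≤m+n (suc (suc a)) p)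
    a<m : a < m
    a<m = <-trans (≤-trans (n<1+n a) a<b) b<m
    disjoint : ∀ {u} → u ∈ take (suc a) P × u ∈ (w ∷ drop b P) → ⊥
    disjoint (u∈ , here refl) = w∉ (∈-take (suc a) P u∈)
    disjoint (u∈ , there u∈′) = Unique-window-∉-drop P U zero (suc a) b a<b u∈ u∈′

  -- The new path is v₀ … v_a v_b v_{b-1} … v_c v_d …, skipping the p vertices strictly between a and c
  -- and the r vertices strictly between b and d.
  crossing-shortcut : ∀ a p q r → suc (suc a + p + q) + r < m →
                      adj G (v a) (v (suc a + p + q)) ≡ true →
                      adj G (v (suc a + p)) (v (suc (suc a + p + q) + r)) ≡ true →
                      PathShorterBy (p + r)
  crossing-shortcut a p q r d<m e e′ = take (suc a) P ++ (reverse segment ++ drop d P) ,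
      (walk-++ G (walk-take G WP x a a<m) e (walk-++ G segment-walk e′ (walk-drop G WP x d d<m)) ,
       ++⁺ (take⁺ (suc a) U)
           (++⁺ (Unique-reverse segment (take⁺ (suc q) (drop⁺ c U))) (drop⁺ d U) segment-disjoint)
           prefix-disjoint) ,
      splice-length a d (reverse segment) (p + r)
                    (trans (cong (λ l → suc a + (l + (p + r))) (trans (length-reverse segment) segment-length)) (lemma a p q r))
                    (<⇒≤ d<m)
    where
    c = suc a + p
    b = c + q
    d = suc b + r
    segment = take (suc q) (drop c P)
    a<c : suc a ≤ c
    a<c = m≤m+n (suc a) p
    b<d : suc b ≤ d
    b<d = m≤m+n (suc b) r
    b<m : b < m
    b<m = ≤-trans b<d (<⇒≤ d<m)
    a<d : suc a ≤ d
    a<d = ≤-trans a<c (≤-trans (m≤m+n c q) (<⇒≤ b<d))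
    a<m : a < m
    a<m = ≤-trans a<d (<⇒≤ d<m)
    q<length : q < length (drop c P)
    q<length = subst (q <_) (sym (length-drop c P)) (m+n≤o⇒m≤o∸n (suc q) (subst (_≤ m) (cong suc (+-comm c q)) b<m))
    segment-walk : Walk G (v b) (v c) (reverse segment)
    segment-walk = walk-reverse G (subst (λ z → Walk G (v c) z segment) (lookupOr-drop x c P q)
                                         (walk-take G (walk-drop G WP x c (≤-<-trans (m≤m+n c q) b<m)) x q q<length))
    segment-length : length segment ≡ suc q
    segment-length = length-take-≤ (suc q) (drop c P) q<length
    segment-disjoint : ∀ {u} → u ∈ reverse segment × u ∈ drop d P → ⊥
    segment-disjoint (u∈ , u∈′) =
      Unique-window-∉-drop P U c (suc q) d (subst (_≤ d) (sym (+-suc c q)) b<d) (reverse⁻ u∈) u∈′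
    prefix-disjoint : ∀ {u} → u ∈ take (suc a) P × u ∈ (reverse segment ++ drop d P) → ⊥
    prefix-disjoint (u∈ , u∈′) with ∈-++⁻ (reverse segment) u∈′
    ... | inj₁ u∈seg = Unique-window-∉-drop P U zero (suc a) c a<c u∈ (∈-take (suc q) (drop c P) (reverse⁻ u∈seg))
    ... | inj₂ u∈d   = Unique-window-∉-drop P U zero (suc a) d a<d u∈ u∈d
    lemma : ∀ a p q r → suc a + (suc q + (p + r)) ≡ suc (suc a + p + q) + r
    lemma = solve-∀

adj-irreflexive : ∀ {n} (G : Graph n) u → adj G u u ≡ true → ⊥
adj-irreflexive G u e with () ← trans (sym e) (irrefl G u)

𝟙-≟-self : ∀ {n} {u w : Fin n} → w ≡ u → 𝟙 (does (w ≟ u)) ≡ 1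
𝟙-≟-self {u = u} refl rewrite dec-true (u ≟ u) refl = refl

module DegreeCount {n : ℕ} (G : Graph n) {x y : Fin n} {P : List (Fin n)} (WP : Walk G x y P) (U : Unique P)
                   (L : ℕ) (L<m : L < length P) where
  open Shortcuts G WP U
  open DecPropositional (_≟_ {n}) using (_∈?_)

  Shortcut : Set
  Shortcut = Σ (List (Fin n)) λ P′ → IsPath G x y P′ × length P′ < m × m ≤ length P′ + (L + L)

  shorterBy⇒Shortcut : ∀ {k} → PathShorterBy k → 1 ≤ k → k ≤ L + L → Shortcut
  shorterBy⇒Shortcut (P′ , P′-path , |P′|+k≡m) 1≤k k≤2L =
    P′ , P′-path , subst (length P′ <_) |P′|+k≡m (m<m+n _ 1≤k) , subst (_≤ _) |P′|+k≡m (+-monoʳ-≤ _ k≤2L)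

  chord⇒Shortcut : ∀ a b → suc (suc a) ≤ b → b < m → b ≤ L + L → adj G (v a) (v b) ≡ true → Shortcut
  chord⇒Shortcut a b a+2≤b b<m b≤2L e with m≤n⇒∃[o]m+o≡n a+2≤b
  ... | o , refl = shorterBy⇒Shortcut (chord-shortcut a (suc o) (subst (_< m) b≡ b<m) (subst (λ z → adj G (v a) (v z) ≡ true) b≡ e))
                            (s≤s z≤n) (≤-trans (s≤s (≤-trans (m≤n+m o a) (n≤1+n _))) b≤2L)
    where
    b≡ : suc (suc a) + o ≡ suc a + suc o
    b≡ = sym (+-suc (suc a) o)

  detour⇒Shortcut : ∀ a b w → suc (suc (suc a)) ≤ b → b < m → b ≤ L + L → w ∉ P →
                    adj G (v a) w ≡ true → adj G (v b) w ≡ true → Shortcut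
  detour⇒Shortcut a b w a+3≤b b<m b≤2L w∉ e e′ with m≤n⇒∃[o]m+o≡n a+3≤b
  ... | o , refl = shorterBy⇒Shortcut (detour-shortcut a (suc o) w (subst (_< m) b≡ b<m) w∉ e
                                              (subst (λ z → adj G w (v z) ≡ true) b≡ (trans (Graph.sym G w _) e′)))
                            (s≤s z≤n) (≤-trans (s≤s (≤-trans (m≤n+m o a) (≤-trans (n≤1+n _) (n≤1+n _)))) b≤2L)
    where
    b≡ : suc (suc (suc a)) + o ≡ suc (suc a) + suc o
    b≡ = sym (+-suc (suc (suc a)) o)

  crossing⇒Shortcut : ∀ a c t → suc (suc a) ≤ c → c < suc (suc (a + t)) → suc (suc (c + t)) < m → c ≤ L →
                      adj G (v a) (v (suc (suc (a + t)))) ≡ true → adj G (v c) (v (suc (suc (c + t)))) ≡ true → Shortcut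
  crossing⇒Shortcut a c t a+2≤c c<a+2+t c+2+t<m c≤L e e′ with m≤n⇒∃[o]m+o≡n a+2≤c | m≤n⇒∃[o]m+o≡n c<a+2+t
  ... | o , refl | q , c+1+q≡a+2+t =
    shorterBy⇒Shortcut (crossing-shortcut a (suc o) (suc q) (suc o) (subst (_< m) (sym far≡) c+2+t<m)
                                (subst (λ z → adj G (v a) (v z) ≡ true) (sym near≡) e)
                                (subst₂ (λ z z′ → adj G (v z) (v z′) ≡ true) (sym (+-suc (suc a) o)) (sym far≡) e′))
             (s≤s z≤n) (+-mono-≤ o<L o<L)
    where
    near≡ : suc a + suc o + suc q ≡ suc (suc (a + t))
    near≡ = trans (lemma a o q) c+1+q≡a+2+t
      where
      lemma : ∀ a o q → suc a + suc o + suc q ≡ suc (suc (suc a) + o) + q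
      lemma = solve-∀
    far≡ : suc (suc a + suc o + suc q) + suc o ≡ suc (suc (suc (suc a) + o + t))
    far≡ = trans (cong (λ z → suc z + suc o) near≡) (lemma a o t)
      where
      lemma : ∀ a o t → suc (suc (suc (a + t))) + suc o ≡ suc (suc (suc (suc a) + o + t))
      lemma = solve-∀
    o<L : suc o ≤ L
    o<L = ≤-trans (s≤s (≤-trans (m≤n+m o a) (n≤1+n _))) c≤L

  offPathAdj : ℕ → Fin n → Bool
  offPathAdj i w = adj G (v i) w ∧ not (does (w ∈? P))

  -- The range test is needed because v is junk beyond the end of P.
  forwardChord : ℕ → ℕ → Bool
  forwardChord i t = (suc (suc (i + t)) <ᵇ m) ∧ adj G (v i) (v (suc (suc (i + t))))

  offPathAdj-true⁻ : ∀ i w → offPathAdj i w ≡ true → adj G (v i) w ≡ true × w ∉ P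
  offPathAdj-true⁻ i w e with adj G (v i) w | w ∈? P
  ... | true | no w∉ = refl , w∉

  forwardChord-true⁻ : ∀ i t → forwardChord i t ≡ true →
                       suc (suc (i + t)) < m × adj G (v i) (v (suc (suc (i + t)))) ≡ true
  forwardChord-true⁻ i t e with suc (suc (i + t)) <ᵇ m in i+2+t<ᵇm
  ... | true = <ᵇ⇒< _ m (Equivalence.from T-≡ i+2+t<ᵇm) , e

  offPathTerm : ℕ → Fin n → ℕ
  offPathTerm i w = 𝟙 (offPathAdj i w)

  -- For i = 0 the second summand counts v₀ itself, which is harmless for an upper bound.
  neighbourTerm : ℕ → Fin n → ℕ
  neighbourTerm i w = 𝟙 (does (w ≟ v (suc i))) + 𝟙 (does (w ≟ v (i ∸ 1)))

  forwardTerm : ℕ → Fin n → ℕ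
  forwardTerm i w = ∑[ t < m ] 𝟙 (forwardChord i t ∧ does (w ≟ v (suc (suc (i + t)))))

  next-counted : ∀ i → 1 ≤ neighbourTerm i (v (suc i))
  next-counted i = ≤-trans (≤-reflexive (sym (𝟙-≟-self {u = v (suc i)} refl))) (m≤m+n _ _)

  previous-counted : ∀ j → 1 ≤ neighbourTerm (suc j) (v j)
  previous-counted j = ≤-trans (≤-reflexive (sym (𝟙-≟-self {u = v j} refl))) (m≤n+m _ _)

  forward-counted : ∀ i o → suc (suc (i + o)) < m → adj G (v i) (v (suc (suc (i + o)))) ≡ true →
                    1 ≤ forwardTerm i (v (suc (suc (i + o))))
  forward-counted i o j<m e = ≤-trans (≤-reflexive (sym term≡1)) (∑<-term m _ o<m)
    where
    term≡1 : 𝟙 (forwardChord i o ∧ does (v (suc (suc (i + o))) ≟ v (suc (suc (i + o))))) ≡ 1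
    term≡1 rewrite Equivalence.to T-≡ (<⇒<ᵇ j<m) | e = 𝟙-≟-self {u = v (suc (suc (i + o)))} refl
    o<m : o < m
    o<m = ≤-trans (s≤s (≤-trans (m≤n+m o i) (≤-trans (n≤1+n _) (n≤1+n _)))) j<m

  onPath-adj-bound : ∀ i j → i < L → j < m → adj G (v i) (v j) ≡ true →
                     1 ≤ neighbourTerm i (v j) + forwardTerm i (v j) ⊎ Shortcut
  onPath-adj-bound i j i<L j<m e with <-cmp j i
  ... | tri≈ _ refl _ = ⊥-elim (adj-irreflexive G (v i) e)
  ... | tri> _ _ i<j with m≤n⇒m<n∨m≡n i<j
  ...   | inj₂ refl = inj₁ (≤-trans (next-counted i) (m≤m+n _ _))
  ...   | inj₁ i+1<j with m≤n⇒∃[o]m+o≡n i+1<j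
  ...     | o , refl = inj₁ (≤-trans (forward-counted i o j<m e) (m≤n+m _ _))
  onPath-adj-bound i j i<L j<m e | tri< j<i _ _ with m≤n⇒m<n∨m≡n j<i
  ... | inj₂ refl = inj₁ (≤-trans (previous-counted j) (m≤m+n _ _))
  ... | inj₁ j+1<i = inj₂ (chord⇒Shortcut j i j+1<i (<-trans i<L L<m) (≤-trans (<⇒≤ i<L) (m≤m+n L L))
                                           (trans (Graph.sym G (v j) (v i)) e))

  adj-bound : ∀ i → i < L → ∀ w →
              𝟙 (adj G (v i) w) ≤ offPathTerm i w + (neighbourTerm i w + forwardTerm i w) ⊎ Shortcut
  adj-bound i i<L w with adj G (v i) w in e
  ... | false = inj₁ z≤n
  ... | true with w ∈? P
  ...   | no _ = inj₁ (s≤s z≤n)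
  ...   | yes w∈ with ∈⇒lookupOr x P w∈
  ...     | j , j<m , refl = onPath-adj-bound i j i<L j<m e

  ∑-neighbourTerm : ∀ i → ∑[ w ∈ allFin n ] neighbourTerm i w ≤ 2
  ∑-neighbourTerm i = ≤-trans (≤-reflexive (∑-distrib-+ (allFin n) _ _))
                              (+-mono-≤ (∑-𝟙-≟ n (v (suc i)) true) (∑-𝟙-≟ n (v (i ∸ 1)) true))

  ∑-forwardTerm : ∀ i → ∑[ w ∈ allFin n ] forwardTerm i w ≤ ∑[ t < m ] 𝟙 (forwardChord i t)
  ∑-forwardTerm i = ≤-trans (≤-reflexive (∑-comm (allFin n) (downFrom m) _))
                            (∑<-mono m (λ t _ → ∑-𝟙-≟ n (v (suc (suc (i + t)))) (forwardChord i t)))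

  degree-bound : ∀ i → i < L →
                 degree G (v i) ≤ ∑[ w ∈ allFin n ] offPathTerm i w + (2 + ∑[ t < m ] 𝟙 (forwardChord i t)) ⊎ Shortcut
  degree-bound i i<L = map₁ (λ deg≤ → begin
      degree G (v i)                                                                      ≤⟨ deg≤ ⟩
      ∑[ w ∈ allFin n ] (offPathTerm i w + (neighbourTerm i w + forwardTerm i w))         ≡⟨ ∑-distrib-+ (allFin n) _ _ ⟩
      ∑∈ (allFin n) (offPathTerm i) + ∑[ w ∈ allFin n ] (neighbourTerm i w + forwardTerm i w)
        ≡⟨ cong (∑∈ (allFin n) (offPathTerm i) +_) (∑-distrib-+ (allFin n) _ _) ⟩
      ∑∈ (allFin n) (offPathTerm i) + (∑∈ (allFin n) (neighbourTerm i) + ∑∈ (allFin n) (forwardTerm i))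
        ≤⟨ +-monoʳ-≤ _ (+-mono-≤ (∑-neighbourTerm i) (∑-forwardTerm i)) ⟩
      ∑∈ (allFin n) (offPathTerm i) + (2 + ∑[ t < m ] 𝟙 (forwardChord i t))                ∎)
    (∑-mono⊎ (allFin n) (λ {w} _ → adj-bound i i<L w))
    where open ≤-Reasoning

  offPath-multiplicity : ∀ w → ∑[ i < L ] offPathTerm i w ≤ 3 ⊎ Shortcut
  offPath-multiplicity w with ∑-𝟙≤⊎FarTruePair (λ i → offPathAdj i w) 2 L
  ... | inj₁ ≤3 = inj₁ ≤3
  ... | inj₂ (i , j , i+2<j , j<L , ei , ej) with offPathAdj-true⁻ i w ei | offPathAdj-true⁻ j w ej
  ...   | e , w∉ | e′ , _ = inj₂ (detour⇒Shortcut i j w (subst (_< j) (+-comm i 2) i+2<j) (<-trans j<L L<m)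
                                                   (≤-trans (<⇒≤ j<L) (m≤m+n L L)) w∉ e e′)

  forwardChord-multiplicity : ∀ t → ∑[ i < L ] 𝟙 (forwardChord i t) ≤ 2 ⊎ Shortcut
  forwardChord-multiplicity t with ∑-𝟙≤⊎FarTruePair (λ i → forwardChord i t) 1 L
  ... | inj₁ ≤2 = inj₁ ≤2
  ... | inj₂ (a , c , a+1<c , c<L , ea , ec) with forwardChord-true⁻ a t ea | forwardChord-true⁻ c t ec
  ...   | a+2+t<m , e | c+2+t<m , e′ with c <? suc (suc (a + t))
  ...     | yes c<a+2+t = inj₂ (crossing⇒Shortcut a c t (subst (_< c) (+-comm a 1) a+1<c) c<a+2+t c+2+t<m (<⇒≤ c<L) e e′)
  ...     | no c≮a+2+t = inj₂ (chord⇒Shortcut a (suc (suc (a + t))) (s≤s (s≤s (m≤m+n a t))) a+2+t<m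
                                              (≤-trans (≮⇒≥ c≮a+2+t) (≤-trans (<⇒≤ c<L) (m≤m+n L L))) e)

  degree-sum-bound : ∑[ i < L ] degree G (v i) ≤ n * 3 + (L * 2 + m * 2) ⊎ Shortcut
  degree-sum-bound with ∑<-mono⊎ L degree-bound
                      | ∑-mono⊎ (allFin n) (λ {w} _ → offPath-multiplicity w)
                      | ∑<-mono⊎ m (λ t _ → forwardChord-multiplicity t)
  ... | inj₂ s | _      | _      = inj₂ s
  ... | inj₁ _ | inj₂ s | _      = inj₂ s
  ... | inj₁ _ | inj₁ _ | inj₂ s = inj₂ s
  ... | inj₁ deg≤ | inj₁ offPath≤ | inj₁ forward≤ = inj₁ (begin
      ∑[ i < L ] degree G (v i)                                                          ≤⟨ deg≤ ⟩
      ∑[ i < L ] (∑∈ (allFin n) (offPathTerm i) + (2 + ∑[ t < m ] 𝟙 (forwardChord i t)))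
        ≡⟨ ∑-distrib-+ (downFrom L) _ _ ⟩
      ∑[ i < L ] ∑∈ (allFin n) (offPathTerm i) + ∑[ i < L ] (2 + ∑[ t < m ] 𝟙 (forwardChord i t))
        ≡⟨ cong₂ _+_ (∑-comm (downFrom L) (allFin n) offPathTerm) (∑-distrib-+ (downFrom L) _ _) ⟩
      ∑[ w ∈ allFin n ] ∑[ i < L ] offPathTerm i w + (∑[ _ < L ] 2 + ∑[ i < L ] ∑[ t < m ] 𝟙 (forwardChord i t))
        ≡⟨ cong (∑[ w ∈ allFin n ] ∑[ i < L ] offPathTerm i w +_)
                (cong₂ _+_ (∑<-const L 2) (∑-comm (downFrom L) (downFrom m) (λ i t → 𝟙 (forwardChord i t)))) ⟩
      ∑[ w ∈ allFin n ] ∑[ i < L ] offPathTerm i w + (L * 2 + ∑[ t < m ] ∑[ i < L ] 𝟙 (forwardChord i t))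
        ≤⟨ +-mono-≤ offPath≤ (+-monoʳ-≤ (L * 2) forward≤) ⟩
      ∑[ _ ∈ allFin n ] 3 + (L * 2 + ∑[ _ < m ] 2)
        ≡⟨ cong₂ (λ a b → a + (L * 2 + b)) (trans (∑-const (allFin n) 3) (cong (_* 3) (length-allFin n)))
                                           (∑<-const m 2) ⟩
      n * 3 + (L * 2 + m * 2)                                                            ∎)
    where open ≤-Reasoning

degree≤n : ∀ {n} (G : Graph n) u → degree G u ≤ n
degree≤n {n} G u = ≤-trans (∑-𝟙≤length (allFin n) (adj G u)) (≤-reflexive (length-allFin n))

module WindowLength (n m δ : ℕ) .{{_ : NonZero δ}} (δ≤n : δ ≤ n) (m≤n : m ≤ n) (20n<mδ : 20 * n < m * δ) where

  L : ℕ
  L = 10 * n / δ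

  Lδ≤10n : L * δ ≤ 10 * n
  Lδ≤10n = m/n*n≤m (10 * n) δ

  10n<δ+Lδ : 10 * n < δ + L * δ
  10n<δ+Lδ = ≤-<-trans (≤-reflexive (m≡m%n+[m/n]*n (10 * n) δ)) (+-monoˡ-< (L * δ) (m%n<n (10 * n) δ))

  2Lδ≤20n : (L + L) * δ ≤ 20 * n
  2Lδ≤20n = begin
    (L + L) * δ       ≡⟨ *-distribʳ-+ δ L L ⟩
    L * δ + L * δ     ≤⟨ +-mono-≤ Lδ≤10n Lδ≤10n ⟩
    10 * n + 10 * n   ≡⟨ lemma n ⟩
    20 * n            ∎
    where
    open ≤-Reasoning
    lemma : ∀ n → 10 * n + 10 * n ≡ 20 * n
    lemma = solve-∀

  20<δ : 20 < δ
  20<δ = *-cancelʳ-< n 20 δ (<-≤-trans 20n<mδ (≤-trans (*-monoˡ-≤ δ m≤n) (≤-reflexive (*-comm n δ))))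

  2L≤n : L + L ≤ n
  2L≤n = *-cancelʳ-≤ (L + L) n 21 (begin
    (L + L) * 21      ≤⟨ *-monoʳ-≤ (L + L) 20<δ ⟩
    (L + L) * δ       ≤⟨ 2Lδ≤20n ⟩
    20 * n            ≤⟨ *-monoˡ-≤ n (n≤1+n 20) ⟩
    21 * n            ≡⟨ *-comm 21 n ⟩
    n * 21            ∎)
    where open ≤-Reasoning

  L<m : L < m
  L<m = *-cancelʳ-< δ L m (≤-<-trans Lδ≤10n (≤-<-trans (*-monoˡ-≤ n (m≤m+n 10 10)) 20n<mδ))

  degree-sum-not-small : L * δ ≤ n * 3 + (L * 2 + m * 2) → ⊥
  degree-sum-not-small Lδ≤ = <⇒≱ 10n<δ+Lδ (begin
    δ + L * δ                        ≤⟨ +-mono-≤ δ≤n Lδ≤ ⟩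
    n + (n * 3 + (L * 2 + m * 2))    ≤⟨ +-monoʳ-≤ n (+-monoʳ-≤ (n * 3) (+-mono-≤ L*2≤n (*-monoˡ-≤ 2 m≤n))) ⟩
    n + (n * 3 + (n + n * 2))        ≡⟨ lemma n ⟩
    7 * n                            ≤⟨ *-monoˡ-≤ n (m≤m+n 7 3) ⟩
    10 * n                           ∎)
    where
    open ≤-Reasoning
    double : ∀ k → k + k ≡ k * 2
    double = solve-∀
    L*2≤n : L * 2 ≤ n
    L*2≤n = subst (_≤ n) (double L) 2L≤n
    lemma : ∀ n → n + (n * 3 + (n + n * 2)) ≡ 7 * n
    lemma = solve-∀

  shortened-enough : ∀ m′ → m ≤ m′ + (L + L) → m * δ ≤ 20 * n + m′ * δ
  shortened-enough m′ m≤ = begin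
    m * δ                    ≤⟨ *-monoˡ-≤ δ m≤ ⟩
    (m′ + (L + L)) * δ       ≡⟨ *-distribʳ-+ δ m′ (L + L) ⟩
    m′ * δ + (L + L) * δ     ≤⟨ +-monoʳ-≤ (m′ * δ) 2Lδ≤20n ⟩
    m′ * δ + 20 * n          ≡⟨ +-comm (m′ * δ) (20 * n) ⟩
    20 * n + m′ * δ          ∎
    where open ≤-Reasoning

lemma2p8 : (n : ℕ) (G : Graph n) (δ : ℕ) → IsMinDegree G δ →
           (x y : Fin n) (P : List (Fin n)) → IsPath G x y P →
           20 * n < length P * δ →
           Σ (List (Fin n)) (λ P′ → IsPath G x y P′ ×
             (length P * δ ≤ 20 * n + length P′ * δ) × (length P′ < length P))
lemma2p8 n G zero _ x y P _ 20n<0 = ⊥-elim (<⇒≱ 20n<0 (≤-trans (≤-reflexive (*-zeroʳ (length P))) z≤n))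
lemma2p8 n G δ@(suc _) (δ≤degree , v₀ , degree-v₀≡δ) x y P (WP , U) 20n<mδ =
  [ (λ degree-sum≤ → ⊥-elim (degree-sum-not-small (≤-trans Lδ≤degree-sum degree-sum≤)))
  , (λ (P′ , P′-path , |P′|<m , m≤|P′|+2L) → P′ , P′-path , shortened-enough (length P′) m≤|P′|+2L , |P′|<m)
  ] degree-sum-bound
  where
  open WindowLength n (length P) δ (subst (_≤ n) degree-v₀≡δ (degree≤n G v₀)) (Unique⇒length≤ P U) 20n<mδ
  open DegreeCount G WP U L L<m
  open Shortcuts G WP U using (v)
  Lδ≤degree-sum : L * δ ≤ ∑[ i < L ] degree G (v i)
  Lδ≤degree-sum = subst (_≤ ∑[ i < L ] degree G (v i)) (∑<-const L δ) (∑<-mono L (λ i _ → δ≤degree (v i)))
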